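{- For every positive integer $N$ there are at least $N$ distinct finite sequences $\sigma$ with $\nu(\sigma)=0$ such that the polynomials $\nu(\sigma;a,b)$ all have the same quadratic polynomial factor $-a+a^2-b-ab+b^2-2c$ (with the same constant $c$).
   Context: For a finite sequence $\sigma=(a_1,\dots,a_M)$ (repetitions allowed; sequences are regarded as multisets), $\nu(\sigma)=\big(\sum a_i\big)^2-\sum a_i^3$, and $\nu(\sigma;a,b)$ denotes the polynomial in the variables $a,b$ obtained by applying $\nu$ to $\sigma$ with $a$ and $b$ adjoined. If $\nu(\sigma)=0$ and $c$ is the sum of the elements of $\sigma$, then $\nu(\sigma;a,b)=-(a+b)(-a+a^2-b-ab+b^2-2c)$. -}

module Defs where

open import Data.Nat using (ℕ)
open import Data.Integer using (ℤ; +_; _+_; _-_; _*_; -_)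
open import Data.List using (List; _∷_; []; map; sum; _++_)

toℤs : List ℕ → List ℤ
toℤs = map (λ n → + n)

sumℤ : List ℤ → ℤ
sumℤ [] = + 0
sumℤ (x ∷ xs) = x + sumℤ xs

ν : List ℤ → ℤ
ν xs = sumℤ xs * sumℤ xs - sumℤ (map (λ x → x * x * x) xs)

νab : List ℕ → ℤ → ℤ → ℤ
νab σ a b = ν (toℤs σ ++ a ∷ b ∷ [])

quadFactor : ℤ → ℤ → ℤ → ℤ
quadFactor c a b = - a + a * a - b - a * b + b * b - (+ 2) * c

-- Call a list of naturals Nicomachean when the sum of its cubes is the square of its sum.
-- The list A ⊗ B of all products ab (a ∈ A, b ∈ B) has sum Σ A · Σ B and sum of cubes
-- Σ A³ · Σ B³, so Nicomachean lists are closed under ⊗.  Starting from D = 1,…,8 and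
-- E = {1,2,3} ⊗ {1,2,3}, both Nicomachean with sum 36 but of lengths 8 and 9, the lists
-- D^i ⊗ E^(K−i) (0 ≤ i ≤ K) all have sum 36^K and pairwise different lengths 8^i 9^(K−i).
-- Finally ν(σ; a, b) = ν(σ) − (a + b)(−a + a² − b − ab + b² − 2 Σσ) is a polynomial identity.
module Submission where

open import Defs
open import Data.Nat as ℕ using (ℕ; zero; suc; _<_; _≤_; _∸_; _^_; NonZero; z<s)
open import Data.Nat.ListAction using (sum)
open import Data.Nat.ListAction.Properties using (sum-++)
import Data.Nat.Properties as ℕ
import Data.Nat.Tactic.RingSolver as ℕ-Solver
open import Data.Integer as ℤ using (ℤ; +_; _+_; _-_; _*_; -_)
import Data.Integer.Properties as ℤ
import Data.Integer.Tactic.RingSolver as ℤ-Solver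
open import Data.Fin using (Fin; toℕ)
open import Data.Fin.Properties using (toℕ-injective; toℕ<n)
open import Data.List using (List; []; _∷_; _++_; map; length; cartesianProductWith)
open import Data.List.Properties using (map-++; map-id; map-∘; map-cong; length-++; length-map)
open import Data.List.Relation.Unary.All using (All; []; _∷_)
import Data.List.Relation.Unary.All as All
import Data.List.Relation.Unary.All.Properties as All
open import Data.List.Relation.Binary.Permutation.Propositional using (_↭_)
open import Data.List.Relation.Binary.Permutation.Propositional.Properties using (↭-length)
open import Data.Product using (Σ; _×_; _,_)
open import Relation.Binary.Definitions using (tri<; tri≈; tri>)
open import Relation.Binary.PropositionalEquality
open import Algebra.Morphism.Definitions ℕ ℕ _≡_ using (Homomorphic₂)
open import Relation.Nullary using (¬_)
open import Relation.Nullary.Decidable using (toWitness)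
open import Data.Unit using (tt)
open import Data.Empty using (⊥-elim)
open import Function using (id)

infixl 7 _⊗_
infixr 8 _⊗^_

_⊗_ : List ℕ → List ℕ → List ℕ
_⊗_ = cartesianProductWith ℕ._*_

_⊗^_ : List ℕ → ℕ → List ℕ
A ⊗^ zero  = 1 ∷ []
A ⊗^ suc n = A ⊗ A ⊗^ n

cube : ℕ → ℕ
cube n = n ℕ.* n ℕ.* n

Nicomachean : List ℕ → Set
Nicomachean xs = sum (map cube xs) ≡ sum xs ℕ.* sum xs

module _ {f : ℕ → ℕ} (f-* : Homomorphic₂ f ℕ._*_ ℕ._*_) where

  sum-map-scale : ∀ a B → sum (map f (map (a ℕ.*_) B)) ≡ f a ℕ.* sum (map f B)
  sum-map-scale a []      = sym (ℕ.*-zeroʳ (f a))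
  sum-map-scale a (b ∷ B) = begin
    f (a ℕ.* b) ℕ.+ sum (map f (map (a ℕ.*_) B)) ≡⟨ cong₂ ℕ._+_ (f-* a b) (sum-map-scale a B) ⟩
    f a ℕ.* f b ℕ.+ f a ℕ.* sum (map f B)         ≡⟨ ℕ.*-distribˡ-+ (f a) (f b) _ ⟨
    f a ℕ.* sum (map f (b ∷ B))                   ∎
    where open ≡-Reasoning

  sum-map-⊗ : ∀ A B → sum (map f (A ⊗ B)) ≡ sum (map f A) ℕ.* sum (map f B)
  sum-map-⊗ []      B = refl
  sum-map-⊗ (a ∷ A) B = begin
    sum (map f (map (a ℕ.*_) B ++ A ⊗ B))                      ≡⟨ cong sum (map-++ f (map (a ℕ.*_) B) (A ⊗ B)) ⟩
    sum (map f (map (a ℕ.*_) B) ++ map f (A ⊗ B))              ≡⟨ sum-++ (map f (map (a ℕ.*_) B)) _ ⟩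
    sum (map f (map (a ℕ.*_) B)) ℕ.+ sum (map f (A ⊗ B))       ≡⟨ cong₂ ℕ._+_ (sum-map-scale a B) (sum-map-⊗ A B) ⟩
    f a ℕ.* sum (map f B) ℕ.+ sum (map f A) ℕ.* sum (map f B)  ≡⟨ ℕ.*-distribʳ-+ (sum (map f B)) (f a) _ ⟨
    sum (map f (a ∷ A)) ℕ.* sum (map f B)                      ∎
    where open ≡-Reasoning

sum-⊗ : ∀ A B → sum (A ⊗ B) ≡ sum A ℕ.* sum B
sum-⊗ A B = begin
  sum (A ⊗ B)                               ≡⟨ cong sum (map-id (A ⊗ B)) ⟨
  sum (map id (A ⊗ B))                      ≡⟨ sum-map-⊗ (λ _ _ → refl) A B ⟩
  sum (map id A) ℕ.* sum (map id B)         ≡⟨ cong₂ (λ xs ys → sum xs ℕ.* sum ys) (map-id A) (map-id B) ⟩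
  sum A ℕ.* sum B                           ∎
  where open ≡-Reasoning

cube-* : Homomorphic₂ cube ℕ._*_ ℕ._*_
cube-* = cube-*-identity
  where
  cube-*-identity : ∀ m n → m ℕ.* n ℕ.* (m ℕ.* n) ℕ.* (m ℕ.* n) ≡ m ℕ.* m ℕ.* m ℕ.* (n ℕ.* n ℕ.* n)
  cube-*-identity = ℕ-Solver.solve-∀

length-⊗ : ∀ A B → length (A ⊗ B) ≡ length A ℕ.* length B
length-⊗ []      B = refl
length-⊗ (a ∷ A) B = begin
  length (map (a ℕ.*_) B ++ A ⊗ B)        ≡⟨ length-++ (map (a ℕ.*_) B) ⟩
  length (map (a ℕ.*_) B) ℕ.+ length (A ⊗ B) ≡⟨ cong₂ ℕ._+_ (length-map (a ℕ.*_) B) (length-⊗ A B) ⟩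
  length B ℕ.+ length A ℕ.* length B      ∎
  where open ≡-Reasoning

Nicomachean-⊗ : ∀ A B → Nicomachean A → Nicomachean B → Nicomachean (A ⊗ B)
Nicomachean-⊗ A B nA nB = begin
  sum (map cube (A ⊗ B))                      ≡⟨ sum-map-⊗ cube-* A B ⟩
  sum (map cube A) ℕ.* sum (map cube B)       ≡⟨ cong₂ ℕ._*_ nA nB ⟩
  (sum A ℕ.* sum A) ℕ.* (sum B ℕ.* sum B)     ≡⟨ interchange (sum A) (sum B) ⟩
  (sum A ℕ.* sum B) ℕ.* (sum A ℕ.* sum B)     ≡⟨ cong₂ ℕ._*_ (sum-⊗ A B) (sum-⊗ A B) ⟨
  sum (A ⊗ B) ℕ.* sum (A ⊗ B)                 ∎
  where
  open ≡-Reasoning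
  interchange : ∀ m n → (m ℕ.* m) ℕ.* (n ℕ.* n) ≡ (m ℕ.* n) ℕ.* (m ℕ.* n)
  interchange = ℕ-Solver.solve-∀

Positive : List ℕ → Set
Positive = All (0 <_)

Positive-⊗ : ∀ {A B} → Positive A → Positive B → Positive (A ⊗ B)
Positive-⊗ []         pB = []
Positive-⊗ (pa ∷ pA) pB = All.++⁺ (All.map⁺ (All.map (ℕ.*-mono-< pa) pB)) (Positive-⊗ pA pB)

module _ {A : List ℕ} where

  sum-⊗^ : ∀ n → sum (A ⊗^ n) ≡ sum A ^ n
  sum-⊗^ zero    = refl
  sum-⊗^ (suc n) = trans (sum-⊗ A (A ⊗^ n)) (cong (sum A ℕ.*_) (sum-⊗^ n))

  length-⊗^ : ∀ n → length (A ⊗^ n) ≡ length A ^ n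
  length-⊗^ zero    = refl
  length-⊗^ (suc n) = trans (length-⊗ A (A ⊗^ n)) (cong (length A ℕ.*_) (length-⊗^ n))

  Nicomachean-⊗^ : Nicomachean A → ∀ n → Nicomachean (A ⊗^ n)
  Nicomachean-⊗^ nA zero    = refl
  Nicomachean-⊗^ nA (suc n) = Nicomachean-⊗ A (A ⊗^ n) nA (Nicomachean-⊗^ nA n)

  Positive-⊗^ : Positive A → ∀ n → Positive (A ⊗^ n)
  Positive-⊗^ pA zero    = z<s ∷ []
  Positive-⊗^ pA (suc n) = Positive-⊗ pA (Positive-⊗^ pA n)

module _ {m n : ℕ} .{{_ : NonZero m}} (m<n : m < n) where

  private instance
    n≢0 : NonZero n
    n≢0 = ℕ.>-nonZero (ℕ.m<n⇒0<n m<n)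

  ^*^-<-shift : ∀ i d e .{{_ : NonZero d}} → m ^ (i ℕ.+ d) ℕ.* n ^ e < m ^ i ℕ.* n ^ (d ℕ.+ e)
  ^*^-<-shift i d e
    rewrite ℕ.^-distribˡ-+-* m i d | ℕ.^-distribˡ-+-* n d e | ℕ.*-assoc (m ^ i) (m ^ d) (n ^ e) =
    ℕ.*-monoʳ-< (m ^ i) {{ℕ.m^n≢0 m i}} (ℕ.*-monoˡ-< (n ^ e) {{ℕ.m^n≢0 n e}} (ℕ.^-monoˡ-< d m<n))

  ^*^∸-anti : ∀ K {i j} → i < j → j ≤ K → m ^ j ℕ.* n ^ (K ∸ j) < m ^ i ℕ.* n ^ (K ∸ i)
  ^*^∸-anti K {i} i<j j≤K
    with d , refl ← ℕ.m≤n⇒∃[o]m+o≡n i<j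
    with e , refl ← ℕ.m≤n⇒∃[o]m+o≡n j≤K
    = subst₂ _<_ left right (^*^-<-shift i (suc d) e)
    where
    left : m ^ (i ℕ.+ suc d) ℕ.* n ^ e ≡ m ^ (suc i ℕ.+ d) ℕ.* n ^ (suc i ℕ.+ d ℕ.+ e ∸ (suc i ℕ.+ d))
    left = cong₂ ℕ._*_ (cong (m ^_) (ℕ.+-suc i d)) (cong (n ^_) (sym (ℕ.m+n∸m≡n (suc i ℕ.+ d) e)))
    right : m ^ i ℕ.* n ^ (suc d ℕ.+ e) ≡ m ^ i ℕ.* n ^ (suc i ℕ.+ d ℕ.+ e ∸ i)
    right = cong (λ k → m ^ i ℕ.* n ^ k) (sym (begin
      suc i ℕ.+ d ℕ.+ e ∸ i    ≡⟨ cong (_∸ i) (ℕ.+-assoc (suc i) d e) ⟩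
      suc i ℕ.+ (d ℕ.+ e) ∸ i  ≡⟨ cong (_∸ i) (ℕ.+-suc i (d ℕ.+ e)) ⟨
      i ℕ.+ suc (d ℕ.+ e) ∸ i  ≡⟨ ℕ.m+n∸m≡n i (suc d ℕ.+ e) ⟩
      suc d ℕ.+ e              ∎))
      where open ≡-Reasoning

  ^*^∸-injective : ∀ K {i j} → i ≤ K → j ≤ K → m ^ i ℕ.* n ^ (K ∸ i) ≡ m ^ j ℕ.* n ^ (K ∸ j) → i ≡ j
  ^*^∸-injective K {i} {j} i≤K j≤K eq with ℕ.<-cmp i j
  ... | tri< i<j _ _ = ⊥-elim (ℕ.<-irrefl (sym eq) (^*^∸-anti K i<j j≤K))
  ... | tri≈ _ i≡j _ = i≡j
  ... | tri> _ _ j<i = ⊥-elim (ℕ.<-irrefl eq (^*^∸-anti K j<i i≤K))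

sumℤ-++ : ∀ xs ys → sumℤ (xs ++ ys) ≡ sumℤ xs + sumℤ ys
sumℤ-++ []       ys = sym (ℤ.+-identityˡ (sumℤ ys))
sumℤ-++ (x ∷ xs) ys = trans (cong (λ t → x + t) (sumℤ-++ xs ys)) (sym (ℤ.+-assoc x (sumℤ xs) (sumℤ ys)))

cubeℤ : ℤ → ℤ
cubeℤ x = x * x * x

ν-++-pair : ∀ xs a b → ν (xs ++ a ∷ b ∷ []) ≡ ν xs + - (a + b) * quadFactor (sumℤ xs) a b
ν-++-pair xs a b
  rewrite sumℤ-++ xs (a ∷ b ∷ []) | map-++ cubeℤ xs (a ∷ b ∷ [])
        | sumℤ-++ (map cubeℤ xs) (cubeℤ a ∷ cubeℤ b ∷ []) =
  identity (sumℤ xs) (sumℤ (map cubeℤ xs)) a b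
  where
  identity : ∀ s t a b →
    (s + (a + (b + + 0))) * (s + (a + (b + + 0))) - (t + (a * a * a + (b * b * b + + 0)))
      ≡ (s * s - t) + - (a + b) * (- a + a * a - b - a * b + b * b - + 2 * s)
  identity = ℤ-Solver.solve-∀

sumℤ-map-pos : ∀ (f : ℕ → ℕ) xs → sumℤ (map (λ n → + f n) xs) ≡ + sum (map f xs)
sumℤ-map-pos f []       = refl
sumℤ-map-pos f (x ∷ xs) = trans (cong (λ t → + f x + t) (sumℤ-map-pos f xs)) (sym (ℤ.pos-+ (f x) _))

sumℤ-toℤs : ∀ xs → sumℤ (toℤs xs) ≡ + sum xs
sumℤ-toℤs xs = trans (sumℤ-map-pos id xs) (cong (λ ys → + sum ys) (map-id xs))

sumℤ-cubes-toℤs : ∀ xs → sumℤ (map cubeℤ (toℤs xs)) ≡ + sum (map cube xs)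
sumℤ-cubes-toℤs xs = begin
  sumℤ (map cubeℤ (toℤs xs))         ≡⟨ cong sumℤ (map-∘ {g = cubeℤ} {f = λ n → + n} xs) ⟨
  sumℤ (map (λ n → cubeℤ (+ n)) xs)  ≡⟨ cong sumℤ (map-cong cubeℤ-pos xs) ⟩
  sumℤ (map (λ n → + cube n) xs)     ≡⟨ sumℤ-map-pos cube xs ⟩
  + sum (map cube xs)                ∎
  where
  open ≡-Reasoning
  cubeℤ-pos : ∀ n → cubeℤ (+ n) ≡ + cube n
  cubeℤ-pos n = trans (cong (_* + n) (sym (ℤ.pos-* n n))) (sym (ℤ.pos-* (n ℕ.* n) n))

ν-Nicomachean : ∀ xs → Nicomachean xs → ν (toℤs xs) ≡ + 0
ν-Nicomachean xs nic
  rewrite sumℤ-toℤs xs | sumℤ-cubes-toℤs xs | nic | ℤ.pos-* (sum xs) (sum xs) =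
  ℤ.+-inverseʳ (+ sum xs * + sum xs)

νab-Nicomachean : ∀ xs → Nicomachean xs → ∀ a b → νab xs a b ≡ - (a + b) * quadFactor (+ sum xs) a b
νab-Nicomachean xs nic a b = begin
  ν (toℤs xs ++ a ∷ b ∷ [])                                   ≡⟨ ν-++-pair (toℤs xs) a b ⟩
  ν (toℤs xs) + - (a + b) * quadFactor (sumℤ (toℤs xs)) a b  ≡⟨ cong₂ (λ v s → v + - (a + b) * quadFactor s a b)
                                                                        (ν-Nicomachean xs nic) (sumℤ-toℤs xs) ⟩
  + 0 + - (a + b) * quadFactor (+ sum xs) a b                 ≡⟨ ℤ.+-identityˡ _ ⟩
  - (a + b) * quadFactor (+ sum xs) a b                       ∎
  where open ≡-Reasoning

D E : List ℕ
D = 1 ∷ 2 ∷ 3 ∷ 4 ∷ 5 ∷ 6 ∷ 7 ∷ 8 ∷ []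
E = (1 ∷ 2 ∷ 3 ∷ []) ⊗ (1 ∷ 2 ∷ 3 ∷ [])

family : ℕ → ℕ → List ℕ
family K i = D ⊗^ i ⊗ E ⊗^ (K ∸ i)

family-Nicomachean : ∀ K i → Nicomachean (family K i)
family-Nicomachean K i =
  Nicomachean-⊗ (D ⊗^ i) (E ⊗^ (K ∸ i)) (Nicomachean-⊗^ D-Nicomachean i) (Nicomachean-⊗^ E-Nicomachean (K ∸ i))
  where
  D-Nicomachean : Nicomachean D
  D-Nicomachean = refl
  E-Nicomachean : Nicomachean E
  E-Nicomachean = refl

family-Positive : ∀ K i → Positive (family K i)
family-Positive K i = Positive-⊗ (Positive-⊗^ D-Positive i) (Positive-⊗^ E-Positive (K ∸ i))
  where
  D-Positive : Positive D
  D-Positive = toWitness {a? = All.all? (0 ℕ.<?_) D} tt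
  E-Positive : Positive E
  E-Positive = toWitness {a? = All.all? (0 ℕ.<?_) E} tt

family-sum : ∀ K i → i ≤ K → sum (family K i) ≡ 36 ^ K
family-sum K i i≤K = begin
  sum (family K i)                    ≡⟨ sum-⊗ (D ⊗^ i) (E ⊗^ (K ∸ i)) ⟩
  sum (D ⊗^ i) ℕ.* sum (E ⊗^ (K ∸ i)) ≡⟨ cong₂ ℕ._*_ (sum-⊗^ i) (sum-⊗^ (K ∸ i)) ⟩
  36 ^ i ℕ.* 36 ^ (K ∸ i)             ≡⟨ ℕ.^-distribˡ-+-* 36 i (K ∸ i) ⟨
  36 ^ (i ℕ.+ (K ∸ i))                ≡⟨ cong (36 ^_) (ℕ.m+[n∸m]≡n i≤K) ⟩
  36 ^ K                              ∎
  where open ≡-Reasoning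

family-length : ∀ K i → length (family K i) ≡ 8 ^ i ℕ.* 9 ^ (K ∸ i)
family-length K i = trans (length-⊗ (D ⊗^ i) (E ⊗^ (K ∸ i)))
                          (cong₂ ℕ._*_ (length-⊗^ i) (length-⊗^ (K ∸ i)))

family-↭-injective : ∀ K {i j} → i ≤ K → j ≤ K → family K i ↭ family K j → i ≡ j
family-↭-injective K {i} {j} i≤K j≤K p = ^*^∸-injective (ℕ.n<1+n 8) K i≤K j≤K
  (trans (sym (family-length K i)) (trans (↭-length p) (family-length K j)))

mainTheorem18 : (N : ℕ) → 0 < N →
    Σ ℤ λ c → Σ (Fin N → List ℕ) λ σ →
      ((i j : Fin N) → i ≢ j → ¬ (σ i ↭ σ j))
      × ((i : Fin N) →
          All (λ x → 0 < x) (σ i)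
          × ν (toℤs (σ i)) ≡ + 0
          × sumℤ (toℤs (σ i)) ≡ c
          × ((a b : ℤ) → νab (σ i) a b ≡ - (a + b) * quadFactor c a b))
mainTheorem18 N _ = + 36 ^ N , σ , distinct , properties
  where
  σ : Fin N → List ℕ
  σ i = family N (toℕ i)
  index≤N : (i : Fin N) → toℕ i ≤ N
  index≤N i = ℕ.<⇒≤ (toℕ<n i)
  distinct : (i j : Fin N) → i ≢ j → ¬ (σ i ↭ σ j)
  distinct i j i≢j p = i≢j (toℕ-injective (family-↭-injective N (index≤N i) (index≤N j) p))
  properties : (i : Fin N) →
    Positive (σ i) × ν (toℤs (σ i)) ≡ + 0 × sumℤ (toℤs (σ i)) ≡ + 36 ^ N
      × ((a b : ℤ) → νab (σ i) a b ≡ - (a + b) * quadFactor (+ 36 ^ N) a b)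
  properties i rewrite sym (family-sum N (toℕ i) (index≤N i)) =
    family-Positive N (toℕ i) , ν-Nicomachean (σ i) nic , sumℤ-toℤs (σ i) , νab-Nicomachean (σ i) nic
    where
    nic : Nicomachean (σ i)
    nic = family-Nicomachean N (toℕ i)
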